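{- \[\liminf_{n\to\infty} m_4(\mathbb{Z}_n)\le \frac{1}{12},\qquad \liminf_{n\to\infty} m_5(\mathbb{Z}_n)\le \frac{1}{38}.\]
   Context: A $k$-term arithmetic progression ($k$-AP) in $\mathbb{Z}_n$ is an ordered sequence $(a,a+d,\dots,a+(k-1)d)$ with $(a,d)\in\mathbb{Z}_n^2$; degenerate progressions are allowed and a progression and its reverse are counted separately, so there are exactly $n^2$ $k$-APs. For a 2-coloring $c:\mathbb{Z}_n\to\{0,1\}$, $m_k(\mathbb{Z}_n,c)$ is the number of pairs $(a,d)\in\mathbb{Z}_n^2$ whose $k$-AP is monochromatic, and $m_k(\mathbb{Z}_n)=\min_c m_k(\mathbb{Z}_n,c)/n^2$. -}

module Defs where

open import Data.Nat using (ℕ; zero; suc; _+_; _*_; _≤_; _⊓_)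
open import Data.Nat.DivMod using (_mod_)
open import Data.Fin using (Fin; toℕ)
import Data.Fin
import Data.Product
open import Data.Bool using (Bool; true; false; _∧_)
open import Data.Bool.Properties using () renaming (_≟_ to _≟ᵇ_)
open import Data.List using (List; []; _∷_; map; concatMap; allFin; upTo; filterᵇ; length; foldr; cartesianProduct)
open import Data.Bool.ListAction using (and)
open import Data.Product using (_×_; _,_; ∃-syntax)
open import Data.Integer using (+_)
open import Data.Rational using (ℚ; 0ℚ; _<_; _/_) renaming (_+_ to _+ℚ_)
open import Relation.Nullary.Decidable using (⌊_⌋)

Coloring : ℕ → Set
Coloring n = Fin n → Bool

allColorings : (n : ℕ) → List (Coloring n)
allColorings zero = (λ ()) ∷ []
allColorings (suc n) =
  concatMap (λ c → (λ { Fin.zero → false ; (Fin.suc i) → c i })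
                 ∷ (λ { Fin.zero → true ; (Fin.suc i) → c i }) ∷ [])
            (allColorings n)

term : {n : ℕ} → Fin (suc n) → Fin (suc n) → ℕ → Fin (suc n)
term {n} a d i = (toℕ a + i * toℕ d) mod (suc n)

isMono : (k : ℕ) {n : ℕ} → Coloring (suc n) → Fin (suc n) → Fin (suc n) → Bool
isMono k c a d = and (map (λ i → ⌊ c (term a d i) ≟ᵇ c a ⌋) (upTo k))

monoCount : (k : ℕ) {n : ℕ} → Coloring (suc n) → ℕ
monoCount k {n} c =
  length (filterᵇ (λ p → isMono k c (Data.Product.proj₁ p) (Data.Product.proj₂ p))
                  (cartesianProduct (allFin (suc n)) (allFin (suc n))))

-- min over all colorings of monoCount (the count never exceeds n², so n² is a
-- neutral starting value for the minimum; the list of colorings is nonempty).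
minMonoCount : (k n : ℕ) → ℕ
minMonoCount k zero = 0
minMonoCount k (suc n) =
  foldr _⊓_ (suc n * suc n) (map (monoCount k) (allColorings (suc n)))

-- m_k(ℤ_n) = min_c m_k(ℤ_n, c) / n².  (ℤ_0 is meaningless; value 0 there is a
-- convention and irrelevant for the liminf.)
m : (k n : ℕ) → ℚ
m k zero = 0ℚ
m k (suc n) = + minMonoCount k (suc n) / (suc n * suc n)

-- liminf_{n→∞} a n ≤ c, unfolded: for every ε > 0 and every N there is n ≥ N
-- with a n < c +ℚ ε.
LiminfLe : (ℕ → ℚ) → ℚ → Set
LiminfLe a c = ∀ (ε : ℚ) → 0ℚ < ε → ∀ (N : ℕ) → ∃[ n ] (N ≤ n × a n < c +ℚ ε)

module Submission where

-- Every bound comes from an explicit colouring.  We work with colourings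
-- col : ℕ → Bool of period M; such a colouring induces a colouring of ℤₙ for
-- every multiple n of M, and its number of monochromatic k-APs in ℤₙ equals
-- apCount k n col, a double sum over ℕ with no reductions modulo n.

open import Defs
open import Data.Nat
  using (ℕ; zero; suc; _+_; _*_; _^_; _≤_; _<_; _⊓_; z≤n; s≤s; NonZero)
open import Data.Nat.Properties
  using ( +-assoc; +-comm; +-identityʳ; *-comm; *-assoc; *-zeroʳ; *-identityʳ; *-distribˡ-+
        ; *-distribʳ-+; ≤-refl; ≤-trans; ≤-<-trans; m≤m+n; m≤n+m; m≤m*n
        ; *-monoˡ-≤; *-mono-≤; +-monoʳ-<; m⊓n≤m; m⊓n≤n; n<1+n; n≤1+n; <⇒≤; ^-monoʳ-<
        ; anyUpTo?; allUpTo?; module ≤-Reasoning)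
open import Data.Nat.DivMod
  using ( _%_; _mod_; m%n<n; m≡m%n+[m/n]*n; [m+kn]%n≡m%n; m<n⇒m%n≡m
        ; %-remove-+ˡ; +-distrib-/-∣ˡ; m*n/n≡m; m<n⇒m/n≡0)
  renaming (_/_ to _/ℕ_)
open import Data.Nat.Divisibility using (divides-refl; ∣-refl)
open import Data.Nat.ListAction using (sum)
open import Data.Nat.ListAction.Properties using (sum-++)
open import Data.Nat.Tactic.RingSolver using (solve-∀)
open import Data.Nat.Coprimality using (Coprime)
open import Data.Integer using (+[1+_]; -[1+_])
import Data.Integer as ℤ
import Data.Integer.Properties as ℤP
open import Data.Rational using (mkℚ; _/_; toℚᵘ) renaming (_<_ to _<ℚ_; _+_ to _+ℚ_)
import Data.Rational as ℚ
import Data.Rational.Properties as ℚP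
open import Data.Rational.Unnormalised using (mkℚᵘ; *<*) renaming (_<_ to _<ᵘ_; _+_ to _+ᵘ_; _≃_ to _≃ᵘ_)
import Data.Rational.Unnormalised.Properties as ℚᵘP
open import Data.Fin using (Fin; toℕ)
import Data.Fin as Fin
open import Data.Fin.Properties using (toℕ-fromℕ<; toℕ-injective)
open import Data.Bool using (Bool; true; false; _∧_; T)
open import Data.Bool.Properties using (¬-not) renaming (_≟_ to _≟ᵇ_)
open import Data.Bool.ListAction using (and; all)
open import Data.Maybe using (Maybe; just; nothing; fromMaybe)
import Data.Maybe.Properties as Maybe
open import Data.List
  using (List; []; _∷_; _++_; map; allFin; upTo; filterᵇ; length; foldr; cartesianProduct; tabulate; lookup)
open import Data.List.Properties using (map-cong; map-++; map-∘)
open import Data.List.Membership.Propositional using (_∈_)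
open import Data.List.Membership.Propositional.Properties using (∈-concat⁺′; ∈-map⁺; ∈-upTo⁺)
open import Data.List.Relation.Unary.Any using (here; there)
import Data.List.Relation.Unary.All as All
open import Data.List.Relation.Unary.All.Properties using (all⁺)
open import Data.Product using (_×_; _,_; ∃-syntax)
open import Data.Empty using (⊥-elim)
open import Relation.Nullary using (contradiction)
open import Data.Unit using (tt)
open import Relation.Nullary.Decidable using (⌊_⌋; toWitness; Dec; _×-dec_)
open import Relation.Binary.PropositionalEquality
open import Function using (_∘_)

iverson : Bool → ℕ
iverson true = 1
iverson false = 0

sumTo : (ℕ → ℕ) → ℕ → ℕ
sumTo F zero = 0
sumTo F (suc n) = F 0 + sumTo (F ∘ suc) n

sumTo-cong : {F G : ℕ → ℕ} (n : ℕ) → (∀ x → x < n → F x ≡ G x) → sumTo F n ≡ sumTo G n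
sumTo-cong zero e = refl
sumTo-cong (suc n) e = cong₂ _+_ (e 0 (s≤s z≤n)) (sumTo-cong n (λ x x<n → e (suc x) (s≤s x<n)))

sumTo-+ : (F : ℕ → ℕ) (a b : ℕ) → sumTo F (a + b) ≡ sumTo F a + sumTo (λ x → F (a + x)) b
sumTo-+ F zero b = refl
sumTo-+ F (suc a) b = trans (cong (F 0 +_) (sumTo-+ (F ∘ suc) a b)) (sym (+-assoc (F 0) _ _))

sumTo-blocks : (F : ℕ → ℕ) (m b : ℕ) →
  sumTo F (m * b) ≡ sumTo (λ q → sumTo (λ r → F (q * b + r)) b) m
sumTo-blocks F zero b = refl
sumTo-blocks F (suc m) b = trans (sumTo-+ F b (m * b))
  (cong (sumTo F b +_) (trans (sumTo-blocks (λ x → F (b + x)) m b)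
    (sumTo-cong m (λ q _ → sumTo-cong b (λ r _ → cong F (sym (+-assoc b (q * b) r)))))))

sumTo-periodic : (F : ℕ → ℕ) (M : ℕ) → (∀ x → F (M + x) ≡ F x) →
  (t : ℕ) → sumTo F (t * M) ≡ t * sumTo F M
sumTo-periodic F M per zero = refl
sumTo-periodic F M per (suc t) = trans (sumTo-+ F M (t * M))
  (cong (sumTo F M +_) (trans (sumTo-cong (t * M) (λ x _ → per x)) (sumTo-periodic F M per t)))

sumTo-scale : (F : ℕ → ℕ) (c n : ℕ) → sumTo (λ x → c * F x) n ≡ c * sumTo F n
sumTo-scale F c zero = sym (*-zeroʳ c)
sumTo-scale F c (suc n) =
  trans (cong (c * F 0 +_) (sumTo-scale (F ∘ suc) c n)) (sym (*-distribˡ-+ c (F 0) _))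

sumTo-pointwise-+ : (F G : ℕ → ℕ) (n : ℕ) →
  sumTo (λ x → F x + G x) n ≡ sumTo F n + sumTo G n
sumTo-pointwise-+ F G zero = refl
sumTo-pointwise-+ F G (suc n) =
  trans (cong (F 0 + G 0 +_) (sumTo-pointwise-+ (F ∘ suc) (G ∘ suc) n)) (interchange (F 0) (G 0) _ _)
  where
  interchange : ∀ a b c d → a + b + (c + d) ≡ a + c + (b + d)
  interchange = solve-∀

sumTo-const : (c n : ℕ) → sumTo (λ _ → c) n ≡ n * c
sumTo-const c zero = refl
sumTo-const c (suc n) = cong (c +_) (sumTo-const c n)

length-filterᵇ : {A : Set} (p : A → Bool) (xs : List A) →
  length (filterᵇ p xs) ≡ sum (map (iverson ∘ p) xs)
length-filterᵇ p [] = refl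
length-filterᵇ p (x ∷ xs) with p x
... | true = cong suc (length-filterᵇ p xs)
... | false = length-filterᵇ p xs

sum-cartesianProduct : {A B : Set} (f : A × B → ℕ) (xs : List A) (ys : List B) →
  sum (map f (cartesianProduct xs ys)) ≡ sum (map (λ x → sum (map (λ y → f (x , y)) ys)) xs)
sum-cartesianProduct f [] ys = refl
sum-cartesianProduct f (x ∷ xs) ys = begin
  sum (map f (map (x ,_) ys ++ cartesianProduct xs ys))
    ≡⟨ cong sum (map-++ f (map (x ,_) ys) _) ⟩
  sum (map f (map (x ,_) ys) ++ map f (cartesianProduct xs ys))
    ≡⟨ sum-++ (map f (map (x ,_) ys)) _ ⟩
  sum (map f (map (x ,_) ys)) + sum (map f (cartesianProduct xs ys))
    ≡⟨ cong₂ _+_ (cong sum (sym (map-∘ ys))) (sum-cartesianProduct f xs ys) ⟩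
  sum (map (λ y → f (x , y)) ys) + sum (map (λ x → sum (map (λ y → f (x , y)) ys)) xs) ∎
  where open ≡-Reasoning

sum-tabulate : (n : ℕ) {A : Set} (g : Fin n → A) (F : A → ℕ) (H : ℕ → ℕ) →
  (∀ i → F (g i) ≡ H (toℕ i)) → sum (map F (tabulate g)) ≡ sumTo H n
sum-tabulate zero g F H e = refl
sum-tabulate (suc n) g F H e =
  cong₂ _+_ (e Fin.zero) (sum-tabulate n (g ∘ Fin.suc) F (H ∘ suc) (e ∘ Fin.suc))

Periodic : ℕ → (ℕ → Bool) → Set
Periodic M col = ∀ x → col (M + x) ≡ col x

periodic-shift : ∀ {M col} → Periodic M col → ∀ t x → col (x + t * M) ≡ col x
periodic-shift {M} {col} per zero x = cong col (+-identityʳ x)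
periodic-shift {M} {col} per (suc t) x = begin
  col (x + (M + t * M))  ≡⟨ cong col (swap-front x M (t * M)) ⟩
  col (M + (x + t * M))  ≡⟨ per (x + t * M) ⟩
  col (x + t * M)        ≡⟨ periodic-shift per t x ⟩
  col x                  ∎
  where
  open ≡-Reasoning
  swap-front : ∀ x M y → x + (M + y) ≡ M + (x + y)
  swap-front = solve-∀

periodic-multiple : ∀ {M col} → Periodic M col → ∀ t → Periodic (t * M) col
periodic-multiple {M} {col} per t x = trans (cong col (+-comm (t * M) x)) (periodic-shift per t x)

periodic-mod : ∀ {n col} → Periodic (suc n) col → ∀ x → col (x % suc n) ≡ col x
periodic-mod {n} {col} per x =
  trans (sym (periodic-shift per (x /ℕ suc n) (x % suc n))) (cong col (sym (m≡m%n+[m/n]*n x (suc n))))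

monoAP : ℕ → (ℕ → Bool) → ℕ → ℕ → Bool
monoAP k col a d = all (λ i → ⌊ col (a + i * d) ≟ᵇ col a ⌋) (upTo k)

apCount : ℕ → ℕ → (ℕ → Bool) → ℕ
apCount k M col = sumTo (λ a → sumTo (λ d → iverson (monoAP k col a d)) M) M

monoAP-constant : ∀ k col a d → monoAP k col a d ≡ true → ∀ i → i < k → col (a + i * d) ≡ col a
monoAP-constant k col a d mono i i<k =
  toWitness (All.lookup (all⁺ _ (upTo k) (subst T (sym mono) tt)) (∈-upTo⁺ i<k))

isMono-periodic : ∀ k {n col} → Periodic (suc n) col →
  (c : Coloring (suc n)) → (∀ x → c x ≡ col (toℕ x)) →
  ∀ a d → isMono k c a d ≡ monoAP k col (toℕ a) (toℕ d)
isMono-periodic k {n} {col} per c induced a d =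
  cong and (map-cong (λ i → cong₂ (λ u v → ⌊ u ≟ᵇ v ⌋) (colour-term i) (induced a)) (upTo k))
  where
  colour-term : ∀ i → c (term a d i) ≡ col (toℕ a + i * toℕ d)
  colour-term i = trans (induced (term a d i))
    (trans (cong col (toℕ-fromℕ< (m%n<n (toℕ a + i * toℕ d) (suc n)))) (periodic-mod per _))

monoCount-periodic : ∀ k {n col} → Periodic (suc n) col →
  (c : Coloring (suc n)) → (∀ x → c x ≡ col (toℕ x)) → monoCount k c ≡ apCount k (suc n) col
monoCount-periodic k {n} {col} per c induced = begin
  monoCount k c
    ≡⟨ length-filterᵇ _ (cartesianProduct points points) ⟩
  sum (map (iverson ∘ mono) (cartesianProduct points points))
    ≡⟨ sum-cartesianProduct (iverson ∘ mono) points points ⟩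
  sum (map (λ a → sum (map (λ d → iverson (mono (a , d))) points)) points)
    ≡⟨ sum-tabulate (suc n) (λ a → a) _ (λ a → sumTo (λ d → iverson (monoAP k col a d)) (suc n))
         (λ a → sum-tabulate (suc n) (λ d → d) _ (λ d → iverson (monoAP k col (toℕ a) d))
                   (λ d → cong iverson (isMono-periodic k per c induced a d))) ⟩
  apCount k (suc n) col ∎
  where
  open ≡-Reasoning
  points : List (Fin (suc n))
  points = allFin (suc n)
  mono : Fin (suc n) × Fin (suc n) → Bool
  mono (a , d) = isMono k c a d

allColorings-complete : ∀ n (c : Coloring n) →
  ∃[ c′ ] (c′ ∈ allColorings n × (∀ x → c′ x ≡ c x))
allColorings-complete zero c = (λ ()) , here refl , λ ()
allColorings-complete (suc n) c with allColorings-complete n (c ∘ Fin.suc)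
... | c′ , c′∈ , c′≗ with c Fin.zero in c₀
... | false = _ , ∈-concat⁺′ (here refl) (∈-map⁺ _ c′∈) , λ { Fin.zero → sym c₀ ; (Fin.suc i) → c′≗ i }
... | true = _ , ∈-concat⁺′ (there (here refl)) (∈-map⁺ _ c′∈) , λ { Fin.zero → sym c₀ ; (Fin.suc i) → c′≗ i }

foldr-⊓-≤ : {A : Set} (F : A → ℕ) (b : ℕ) {xs : List A} {x : A} →
  x ∈ xs → foldr _⊓_ b (map F xs) ≤ F x
foldr-⊓-≤ F b {y ∷ xs} (here refl) = m⊓n≤m (F y) _
foldr-⊓-≤ F b {y ∷ xs} (there x∈xs) = ≤-trans (m⊓n≤n (F y) _) (foldr-⊓-≤ F b x∈xs)

minMonoCount-≤ : ∀ k M col → Periodic M col → minMonoCount k M ≤ apCount k M col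
minMonoCount-≤ k zero col per = z≤n
minMonoCount-≤ k (suc n) col per with allColorings-complete (suc n) (col ∘ toℕ)
... | c , c∈ , c≗ = subst (minMonoCount k (suc n) ≤_) (monoCount-periodic k per c c≗)
                      (foldr-⊓-≤ (monoCount k) (suc n * suc n) c∈)

fraction-below : ∀ X e q p d .{c : Coprime (suc p) (suc d)} →
  X * (suc q * suc d) < (suc d + suc p * suc q) * suc e →
  ℤ.+ X / suc e <ℚ ℤ.+ 1 / suc q +ℚ mkℚ +[1+ p ] d c
fraction-below X e q p d {c} h =
  ℚP.toℚᵘ-cancel-< (ℚᵘP.<-respˡ-≃ lhs (ℚᵘP.<-respʳ-≃ rhs unnormalised))
  where
  unnormalised : mkℚᵘ (ℤ.+ X) e <ᵘ mkℚᵘ (ℤ.+ 1) q +ᵘ mkℚᵘ +[1+ p ] d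
  unnormalised = *<* (subst₂ ℤ._<_ (ℤP.pos-* X (suc q * suc d))
    (trans (ℤP.pos-* (suc d + suc p * suc q) (suc e))
      (cong (ℤ._* ℤ.+ suc e) (cong₂ ℤ._+_ (sym (ℤP.*-identityˡ (ℤ.+ suc d))) (ℤP.pos-* (suc p) (suc q)))))
    (ℤ.+<+ h))
  lhs : mkℚᵘ (ℤ.+ X) e ≃ᵘ toℚᵘ (ℤ.+ X / suc e)
  lhs = ℚᵘP.≃-sym (ℚP.toℚᵘ-fromℚᵘ (mkℚᵘ (ℤ.+ X) e))
  rhs : mkℚᵘ (ℤ.+ 1) q +ᵘ mkℚᵘ +[1+ p ] d ≃ᵘ toℚᵘ (ℤ.+ 1 / suc q +ℚ mkℚ +[1+ p ] d c)
  rhs = ℚᵘP.≃-sym (ℚᵘP.≃-trans (ℚP.toℚᵘ-homo-+ (ℤ.+ 1 / suc q) (mkℚ +[1+ p ] d c))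
                     (ℚᵘP.+-congˡ _ (ℚP.toℚᵘ-fromℚᵘ (mkℚᵘ (ℤ.+ 1) q))))

cross-multiplied : ∀ X n q p d E →
  X * suc q ≤ suc n * suc n + E → E * suc d < suc n →
  X * (suc q * suc d) < (suc d + suc p * suc q) * (suc n * suc n)
cross-multiplied X n q p d E bound small = begin-strict
  X * (suc q * suc d)          ≡⟨ sym (*-assoc X (suc q) (suc d)) ⟩
  X * suc q * suc d            ≤⟨ *-monoˡ-≤ (suc d) bound ⟩
  (nn + E) * suc d             ≡⟨ *-distribʳ-+ (suc d) nn E ⟩
  nn * suc d + E * suc d       <⟨ +-monoʳ-< (nn * suc d) (≤-trans small (≤-trans n≤nn nn≤nnPQ)) ⟩
  nn * suc d + nn * (suc p * suc q) ≡⟨ regroup nn (suc d) (suc p * suc q) ⟩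
  (suc d + suc p * suc q) * nn ∎
  where
  open ≤-Reasoning
  nn : ℕ
  nn = suc n * suc n
  n≤nn : suc n ≤ nn
  n≤nn = m≤m*n (suc n) (suc n)
  nn≤nnPQ : nn ≤ nn * (suc p * suc q)
  nn≤nnPQ = m≤m*n nn (suc p * suc q)
  regroup : ∀ a b c → a * b + a * c ≡ (b + c) * a
  regroup = solve-∀

OftenNearly : ℕ → ℕ → ℕ → Set
OftenNearly k q E = ∀ N → ∃[ n ] (N ≤ n × minMonoCount k n * suc q ≤ n * n + E)

-- Given ε = P/D > 0, take n ≥ N with n > E·D among the good sizes.
liminf-criterion : ∀ k q E → OftenNearly k q E → LiminfLe (m k) (ℤ.+ 1 / suc q)
liminf-criterion k q E often (mkℚ (ℤ.+ zero) d c) (ℚ.*<* h) N = ⊥-elim (ℤP.<-irrefl refl h)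
liminf-criterion k q E often (mkℚ -[1+ p ] d c) (ℚ.*<* ()) N
liminf-criterion k q E often (mkℚ +[1+ p ] d c) _ N with often (N + suc (E * suc d))
... | suc n , large , bound =
  suc n , ≤-trans (m≤m+n N _) large ,
  fraction-below (minMonoCount k (suc n)) (n + n * suc n) q p d
    (cross-multiplied (minMonoCount k (suc n)) n q p d E bound
      (≤-trans (m≤n+m (suc (E * suc d)) N) large))
... | zero , large , _ with ≤-trans (m≤n+m (suc (E * suc d)) N) large
...   | ()

monoAP-shift-start : ∀ k {M col} → Periodic M col → ∀ a d → monoAP k col (M + a) d ≡ monoAP k col a d
monoAP-shift-start k {M} {col} per a d = cong and (map-cong (λ i → cong₂ (λ u v → ⌊ u ≟ᵇ v ⌋)
  (trans (cong col (+-assoc M a (i * d))) (per (a + i * d))) (per a)) (upTo k))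

monoAP-shift-step : ∀ k {M col} → Periodic M col → ∀ a d → monoAP k col a (M + d) ≡ monoAP k col a d
monoAP-shift-step k {M} {col} per a d = cong and (map-cong (λ i → cong (λ u → ⌊ u ≟ᵇ col a ⌋)
  (trans (cong col (distribute a i M d)) (periodic-shift per i (a + i * d)))) (upTo k))
  where
  distribute : ∀ a i M d → a + i * (M + d) ≡ a + i * d + i * M
  distribute = solve-∀

apCount-blowup : ∀ k {M col} → Periodic M col → ∀ s → apCount k (s * M) col ≡ s * (s * apCount k M col)
apCount-blowup k {M} {col} per s = begin
  sumTo (λ a → sumTo (row a) (s * M)) (s * M)
    ≡⟨ sumTo-cong (s * M) (λ a _ → sumTo-periodic (row a) M (λ d → cong iverson (monoAP-shift-step k per a d)) s) ⟩
  sumTo (λ a → s * sumTo (row a) M) (s * M)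
    ≡⟨ sumTo-periodic _ M (λ a → cong (λ r → s * r)
         (sumTo-cong M (λ d _ → cong iverson (monoAP-shift-start k per a d)))) s ⟩
  s * sumTo (λ a → s * sumTo (row a) M) M
    ≡⟨ cong (s *_) (sumTo-scale (λ a → sumTo (row a) M) s M) ⟩
  s * (s * apCount k M col) ∎
  where
  open ≡-Reasoning
  row : ℕ → ℕ → ℕ
  row a d = iverson (monoAP k col a d)

periodic-often : ∀ k q M col → Periodic (suc M) col →
  apCount k (suc M) col * suc q ≤ suc M * suc M → OftenNearly k q 0
periodic-often k q M col per dense N = s * suc M , ≤-trans (n≤1+n N) (m≤m*n s (suc M)) , bound
  where
  s C : ℕ
  s = suc N
  C = apCount k (suc M) col
  bound : minMonoCount k (s * suc M) * suc q ≤ s * suc M * (s * suc M) + 0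
  bound = begin
    minMonoCount k (s * suc M) * suc q ≤⟨ *-monoˡ-≤ (suc q) (minMonoCount-≤ k _ col (periodic-multiple per s)) ⟩
    apCount k (s * suc M) col * suc q  ≡⟨ cong (_* suc q) (apCount-blowup k per s) ⟩
    s * (s * C) * suc q                ≡⟨ reassociate s C (suc q) ⟩
    s * s * (C * suc q)                ≤⟨ *-mono-≤ (≤-refl {s * s}) dense ⟩
    s * s * (suc M * suc M)            ≡⟨ square-product s (suc M) ⟩
    s * suc M * (s * suc M) + 0        ∎
    where
    open ≤-Reasoning
    reassociate : ∀ s C Q → s * (s * C) * Q ≡ s * s * (C * Q)
    reassociate = solve-∀
    square-product : ∀ s M → s * s * (M * M) ≡ s * M * (s * M) + 0
    square-product = solve-∀

-- A 44-periodic colouring whose only monochromatic 5-APs are the 44 trivial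
-- ones (difference 0).
pattern₅ : List Bool
pattern₅ =
  false ∷ false ∷ true ∷ false ∷ false ∷ false ∷ false ∷ true ∷ true ∷ true ∷ false ∷
  true ∷ false ∷ false ∷ false ∷ true ∷ false ∷ true ∷ true ∷ false ∷ true ∷ true ∷
  true ∷ true ∷ false ∷ true ∷ true ∷ true ∷ true ∷ false ∷ false ∷ false ∷ true ∷
  false ∷ true ∷ true ∷ true ∷ false ∷ true ∷ false ∷ false ∷ true ∷ false ∷ false ∷ []

colouring₅ : ℕ → Bool
colouring₅ x = lookup pattern₅ (x mod 44)

colouring₅-periodic : Periodic 44 colouring₅
colouring₅-periodic x = cong (lookup pattern₅) (toℕ-injective (begin
  toℕ ((44 + x) mod 44) ≡⟨ toℕ-fromℕ< (m%n<n (44 + x) 44) ⟩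
  (44 + x) % 44         ≡⟨ %-remove-+ˡ x (∣-refl {44}) ⟩
  x % 44                ≡⟨ toℕ-fromℕ< (m%n<n x 44) ⟨
  toℕ (x mod 44)        ∎))
  where open ≡-Reasoning

colouring₅-count : apCount 5 44 colouring₅ ≡ 44
colouring₅-count = refl

-- Density 44/44² = 1/44 ≤ 1/38.
liminf-m₅ : LiminfLe (m 5) (ℤ.+ 1 / 38)
liminf-m₅ = liminf-criterion 5 37 0 (periodic-often 5 37 43 colouring₅ colouring₅-periodic density)
  where
  density : apCount 5 44 colouring₅ * 38 ≤ 44 * 44
  density rewrite colouring₅-count = *-mono-≤ (≤-refl {44}) (m≤n+m 38 6)

leading-% : ∀ q y b .{{_ : NonZero b}} → (q * b + y) % b ≡ y % b
leading-% q y b = trans (cong (_% b) (+-comm (q * b) y)) ([m+kn]%n≡m%n y q b)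

digit-% : ∀ q r b .{{_ : NonZero b}} → r < b → (q * b + r) % b ≡ r
digit-% q r b r<b = trans (leading-% q r b) (m<n⇒m%n≡m r<b)

digit-/ : ∀ q r b .{{_ : NonZero b}} → r < b → (q * b + r) /ℕ b ≡ q
digit-/ q r b r<b = trans (+-distrib-/-∣ˡ r (divides-refl q))
  (trans (cong₂ _+_ (m*n/n≡m q b) (m<n⇒m/n≡0 r<b)) (+-identityʳ q))

template : ℕ → Maybe Bool
template 0 = just false
template 1 = just false
template 2 = just false
template 3 = just true
template 4 = just false
template 5 = nothing
template 6 = just true
template 7 = just false
template 8 = just true
template 9 = just true
template _ = just true

substitute : (ℕ → Bool) → ℕ → Bool
substitute col y = fromMaybe (col (y /ℕ 11)) (template (y % 11))

substitute-digit : ∀ col q r → r < 11 → substitute col (q * 11 + r) ≡ fromMaybe (col q) (template r)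
substitute-digit col q r r<11 =
  cong₂ (λ u v → fromMaybe (col u) (template v)) (digit-/ q r 11 r<11) (digit-% q r 11 r<11)

substitute-periodic : ∀ {M col} → Periodic M col → Periodic (M * 11) (substitute col)
substitute-periodic {M} {col} per y =
  trans (cong₂ (λ u v → fromMaybe (col u) (template v)) quotient (leading-% M y 11))
        (cong (λ b → fromMaybe b (template (y % 11))) (per (y /ℕ 11)))
  where
  quotient : (M * 11 + y) /ℕ 11 ≡ M + y /ℕ 11
  quotient = trans (+-distrib-/-∣ˡ y (divides-refl M)) (cong (_+ y /ℕ 11) (m*n/n≡m M 11))

-- What a progression sees at a template position: the hole passes the
-- question on to col, a fixed colour answers "monochromatic".
holeOr : Maybe Bool → Bool → Bool
holeOr nothing b = b
holeOr (just _) _ = true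

all-true : {A : Set} (p : A → Bool) → (∀ x → p x ≡ true) → ∀ xs → all p xs ≡ true
all-true p always [] = refl
all-true p always (x ∷ xs) = cong₂ _∧_ (always x) (all-true p always xs)

-- A progression whose difference is divisible by 11 stays at one template
-- position r; in the hole it is the progression (q, q + e, …) of col.
monoAP-aligned : ∀ k col q r e → r < 11 →
  monoAP k (substitute col) (q * 11 + r) (e * 11) ≡ holeOr (template r) (monoAP k col q e)
monoAP-aligned k col q r e r<11 =
  trans (cong and (map-cong (λ i → cong₂ (λ u v → ⌊ u ≟ᵇ v ⌋) (colour-of i) (substitute-digit col q r r<11)) (upTo k)))
        (hole-or (template r))
  where
  regroup : ∀ q r i e → q * 11 + r + i * (e * 11) ≡ (q + i * e) * 11 + r
  regroup = solve-∀
  colour-of : ∀ i → substitute col (q * 11 + r + i * (e * 11)) ≡ fromMaybe (col (q + i * e)) (template r)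
  colour-of i = trans (cong (substitute col) (regroup q r i e)) (substitute-digit col (q + i * e) r r<11)
  hole-or : ∀ t → all (λ i → ⌊ fromMaybe (col (q + i * e)) t ≟ᵇ fromMaybe (col q) t ⌋) (upTo k)
                ≡ holeOr t (monoAP k col q e)
  hole-or nothing = refl
  hole-or (just true) = all-true _ (λ _ → refl) (upTo k)
  hole-or (just false) = all-true _ (λ _ → refl) (upTo k)

MeetsBothColours : ℕ → ℕ → Set
MeetsBothColours r f =
  (∃[ i ] (i < 4 × template ((r + i * f) % 11) ≡ just true)) ×
  (∃[ j ] (j < 4 × template ((r + j * f) % 11) ≡ just false))

meetsBothColours? : ∀ r f → Dec (MeetsBothColours r f)
meetsBothColours? r f =
  anyUpTo? (λ i → template ((r + i * f) % 11) ≟ just true) 4 ×-dec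
  anyUpTo? (λ j → template ((r + j * f) % 11) ≟ just false) 4
  where _≟_ = Maybe.≡-dec _≟ᵇ_

misaligned-meets-both : ∀ {r f} → r < 11 → f < 10 → MeetsBothColours r (suc f)
misaligned-meets-both r<11 f<10 =
  toWitness {a? = allUpTo? (λ r → allUpTo? (λ f → meetsBothColours? r (suc f)) 10) 11} tt r<11 f<10

monoAP-misaligned : ∀ col q r e f → r < 11 → f < 10 →
  monoAP 4 (substitute col) (q * 11 + r) (e * 11 + suc f) ≡ false
monoAP-misaligned col q r e f r<11 f<10 = ¬-not not-mono
  where
  a d : ℕ
  a = q * 11 + r
  d = e * 11 + suc f
  regroup : ∀ q r i e f → q * 11 + r + i * (e * 11 + f) ≡ (q + i * e) * 11 + (r + i * f)
  regroup = solve-∀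
  fixed : ∀ i b → template ((r + i * suc f) % 11) ≡ just b → substitute col (a + i * d) ≡ b
  fixed i b t≡b = cong (fromMaybe (col ((a + i * d) /ℕ 11))) (trans (cong template residue) t≡b)
    where
    residue : (a + i * d) % 11 ≡ (r + i * suc f) % 11
    residue = trans (cong (_% 11) (regroup q r i e (suc f))) (leading-% (q + i * e) (r + i * suc f) 11)
  colours-agree : monoAP 4 (substitute col) a d ≡ true → MeetsBothColours r (suc f) → true ≡ false
  colours-agree mono ((i , i<4 , tᵢ) , (j , j<4 , tⱼ)) = begin
    true                          ≡⟨ fixed i true tᵢ ⟨
    substitute col (a + i * d)    ≡⟨ monoAP-constant 4 (substitute col) a d mono i i<4 ⟩
    substitute col a              ≡⟨ monoAP-constant 4 (substitute col) a d mono j j<4 ⟨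
    substitute col (a + j * d)    ≡⟨ fixed j false tⱼ ⟩
    false                         ∎
    where open ≡-Reasoning
  not-mono : monoAP 4 (substitute col) a d ≢ true
  not-mono mono = contradiction (colours-agree mono (misaligned-meets-both r<11 f<10)) (λ ())

-- For a start at template position r, only the differences divisible by 11
-- contribute.
row-count : ∀ col M q r → r < 11 →
  sumTo (λ d → iverson (monoAP 4 (substitute col) (q * 11 + r) d)) (M * 11)
  ≡ sumTo (λ e → iverson (holeOr (template r) (monoAP 4 col q e))) M
row-count col M q r r<11 =
  trans (sumTo-blocks _ M 11) (sumTo-cong M (λ e _ → block e))
  where
  block : ∀ e → sumTo (λ f → iverson (monoAP 4 (substitute col) (q * 11 + r) (e * 11 + f))) 11
              ≡ iverson (holeOr (template r) (monoAP 4 col q e))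
  block e = trans (cong₂ _+_ aligned misaligned) (+-identityʳ _)
    where
    aligned : iverson (monoAP 4 (substitute col) (q * 11 + r) (e * 11 + 0))
            ≡ iverson (holeOr (template r) (monoAP 4 col q e))
    aligned = cong iverson (trans (cong (monoAP 4 (substitute col) (q * 11 + r)) (+-identityʳ (e * 11)))
                                  (monoAP-aligned 4 col q r e r<11))
    misaligned : sumTo (λ f → iverson (monoAP 4 (substitute col) (q * 11 + r) (e * 11 + suc f))) 10 ≡ 0
    misaligned = trans (sumTo-cong 10 (λ f f<10 → cong iverson (monoAP-misaligned col q r e f r<11 f<10)))
                       (sumTo-const 0 10)

-- Summing over the eleven template positions: ten fixed positions contribute
-- every difference, the hole contributes the monochromatic APs of col.
positions-count : ∀ M (B : ℕ → Bool) →
  sumTo (λ r → sumTo (λ e → iverson (holeOr (template r) (B e))) M) 11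
  ≡ 10 * M + sumTo (iverson ∘ B) M
positions-count M B =
  trans (ten-and-one (sumTo (iverson ∘ B) M) (sumTo (λ _ → 1) M))
        (cong (λ K → 10 * K + sumTo (iverson ∘ B) M) (trans (sumTo-const 1 M) (*-identityʳ M)))
  where
  ten-and-one : ∀ A K → K + (K + (K + (K + (K + (A + (K + (K + (K + (K + (K + 0))))))))))
                        ≡ 10 * K + A
  ten-and-one = solve-∀

apCount-substitute : ∀ M col → apCount 4 (M * 11) (substitute col) ≡ 10 * (M * M) + apCount 4 M col
apCount-substitute M col = begin
  apCount 4 (M * 11) (substitute col)
    ≡⟨ sumTo-blocks _ M 11 ⟩
  sumTo (λ q → sumTo (λ r → sumTo (row (q * 11 + r)) (M * 11)) 11) M
    ≡⟨ sumTo-cong M (λ q _ → trans (sumTo-cong 11 (λ r r<11 → row-count col M q r r<11))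
                                    (positions-count M (monoAP 4 col q))) ⟩
  sumTo (λ q → 10 * M + sumTo (λ e → iverson (monoAP 4 col q e)) M) M
    ≡⟨ sumTo-pointwise-+ (λ _ → 10 * M) _ M ⟩
  sumTo (λ _ → 10 * M) M + apCount 4 M col
    ≡⟨ cong (_+ apCount 4 M col) (trans (sumTo-const (10 * M) M) (swap M)) ⟩
  10 * (M * M) + apCount 4 M col ∎
  where
  open ≡-Reasoning
  row : ℕ → ℕ → ℕ
  row a d = iverson (monoAP 4 (substitute col) a d)
  swap : ∀ M → M * (10 * M) ≡ 10 * (M * M)
  swap = solve-∀

colouring₄ : ℕ → ℕ → Bool
colouring₄ zero = λ _ → false
colouring₄ (suc j) = substitute (colouring₄ j)

power-step : ∀ j → 11 ^ suc j ≡ 11 ^ j * 11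
power-step j = *-comm 11 (11 ^ j)

colouring₄-periodic : ∀ j → Periodic (11 ^ j) (colouring₄ j)
colouring₄-periodic zero x = refl
colouring₄-periodic (suc j) =
  subst (λ M → Periodic M (colouring₄ (suc j))) (sym (power-step j)) (substitute-periodic (colouring₄-periodic j))

colouring₄-count : ∀ j → 12 * apCount 4 (11 ^ j) (colouring₄ j) ≡ 11 ^ j * 11 ^ j + 11
colouring₄-count zero = refl
colouring₄-count (suc j) = begin
  12 * apCount 4 (11 ^ suc j) (colouring₄ (suc j))
    ≡⟨ cong (λ n → 12 * apCount 4 n (colouring₄ (suc j))) (power-step j) ⟩
  12 * apCount 4 (M * 11) (substitute (colouring₄ j))
    ≡⟨ cong (12 *_) (apCount-substitute M (colouring₄ j)) ⟩
  12 * (10 * (M * M) + C)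
    ≡⟨ distribute M C ⟩
  120 * (M * M) + 12 * C
    ≡⟨ cong (120 * (M * M) +_) (colouring₄-count j) ⟩
  120 * (M * M) + (M * M + 11)
    ≡⟨ square M ⟩
  M * 11 * (M * 11) + 11
    ≡⟨ cong (λ n → n * n + 11) (power-step j) ⟨
  11 ^ suc j * 11 ^ suc j + 11 ∎
  where
  open ≡-Reasoning
  M C : ℕ
  M = 11 ^ j
  C = apCount 4 M (colouring₄ j)
  distribute : ∀ M C → 12 * (10 * (M * M) + C) ≡ 120 * (M * M) + 12 * C
  distribute = solve-∀
  square : ∀ M → 120 * (M * M) + (M * M + 11) ≡ M * 11 * (M * 11) + 11
  square = solve-∀

n<bⁿ : ∀ b → 1 < b → ∀ n → n < b ^ n
n<bⁿ b 1<b zero = s≤s z≤n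
n<bⁿ b 1<b (suc n) = ≤-<-trans (n<bⁿ b 1<b n) (^-monoʳ-< b 1<b (n<1+n n))

liminf-m₄ : LiminfLe (m 4) (ℤ.+ 1 / 12)
liminf-m₄ = liminf-criterion 4 11 11 often
  where
  often : OftenNearly 4 11 11
  often N = 11 ^ N , <⇒≤ (n<bⁿ 11 (s≤s (s≤s z≤n)) N) , (begin
    minMonoCount 4 (11 ^ N) * 12              ≤⟨ *-monoˡ-≤ 12 (minMonoCount-≤ 4 _ _ (colouring₄-periodic N)) ⟩
    apCount 4 (11 ^ N) (colouring₄ N) * 12    ≡⟨ *-comm (apCount 4 (11 ^ N) (colouring₄ N)) 12 ⟩
    12 * apCount 4 (11 ^ N) (colouring₄ N)    ≡⟨ colouring₄-count N ⟩
    11 ^ N * 11 ^ N + 11                      ∎)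
    where open ≤-Reasoning

-- Data.Integer's +_ is opened only here: above, it would clash with sections (x +_).
open import Data.Integer using (+_)

theorem5 : LiminfLe (m 4) (+ 1 / 12) × LiminfLe (m 5) (+ 1 / 38)
theorem5 = liminf-m₄ , liminf-m₅
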